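{- Let $q\ge5$ be prime, $q^*=(-1)^{(q-1)/2}q$ and $u_q(j)=(3^j-q^*(-1)^j)/4$. Let $p>3$ be a prime with $p\ne q$ and $\operatorname{ord}_p(9)=(p-1)/2$. Then $\iota_q(p)<\rho_q(p)$.
   Context: $\iota_q(p)$ (the incongruence index) is the largest integer $k$ such that $u_q(1),\ldots,u_q(k)$ are pairwise incongruent modulo $p$. $\rho_q(p)$ is the period of $(u_q(j))_{j\ge1}$ modulo $p$, i.e. the smallest $k\ge1$ with $u_q(n)\equiv u_q(n+k)\pmod p$ for all sufficiently large $n$. $\operatorname{ord}_p(9)$ is the multiplicative order of $9$ modulo $p$. -}

module Defs where

open import Data.Nat as ℕ using (ℕ; suc; _≤_; _<_)
open import Data.Integer as ℤ using (ℤ; +_; -_; _-_; _^_)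
open import Data.Integer.Divisibility using (_∣_)
open import Data.Product using (_×_; ∃)
open import Relation.Nullary using (¬_)

_≡_[mod_] : ℤ → ℤ → ℕ → Set
a ≡ b [mod m ] = (+ m) ∣ (a - b)

qstar : ℕ → ℤ
qstar q = ((- (+ 1)) ^ ((q ℕ.∸ 1) ℕ./ 2)) ℤ.* (+ q)

-- u_q(j) = (3^j - q*(-1)^j)/4   (exact division for prime q ≥ 5, since q* ≡ 1 mod 4)
u : ℕ → ℕ → ℤ
u q j = ((+ 3) ^ j - qstar q ℤ.* ((- (+ 1)) ^ j)) ℤ./ (+ 4)

PairwiseIncongruent : ℕ → ℕ → ℕ → Set
PairwiseIncongruent q p k =
  ∀ i j → 1 ≤ i → i < j → j ≤ k → ¬ (u q i ≡ u q j [mod p ])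

IsIncongruenceIndex : ℕ → ℕ → ℕ → Set
IsIncongruenceIndex q p k =
  PairwiseIncongruent q p k × (∀ m → k < m → ¬ PairwiseIncongruent q p m)

IsEventualPeriod : ℕ → ℕ → ℕ → Set
IsEventualPeriod q p k =
  1 ≤ k × (∃ λ N → ∀ n → N ≤ n → 1 ≤ n → u q n ≡ u q (n ℕ.+ k) [mod p ])

IsPeriod : ℕ → ℕ → ℕ → Set
IsPeriod q p k =
  IsEventualPeriod q p k × (∀ m → IsEventualPeriod q p m → k ≤ m)

IsOrder : ℕ → ℕ → ℕ → Set
IsOrder p a k =
  1 ≤ k × (((+ a) ^ k) ≡ (+ 1) [mod p ])
  × (∀ m → 1 ≤ m → ((+ a) ^ m) ≡ (+ 1) [mod p ] → k ≤ m)

-- Write p = 2k + 1 and v j = 3^j − q*(−1)^j = 4 u_q(j). As 9 has order k modulo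
-- p, an eventual period ρ of v forces p ∣ 3^ρ − 1 and p ∣ 1 − (−1)^ρ, so ρ = 2r with 9^r ≡ 1,
-- whence ρ ≥ 2k = p − 1. If ι ≥ ρ, then v 1, …, v (p − 1) are pairwise incongruent, so their
-- residues are all residues modulo p but one, c. The geometric sums give ∑ v j ≡ 0 (using
-- 9^k ≡ 1), hence c ≡ 0 and ∑ (v j)² ≡ ∑_{x<p} x² ≡ 0. But expanding the square,
-- ∑ (v j)² ≡ (p − 1) q*² ≡ −q² ≢ 0 (mod p).
module Submission where

open import Defs
open import Data.Nat using (ℕ; _≤_; _<_; _∸_; _/_)
open import Data.Nat.Primality using (Prime)
open import Relation.Binary.PropositionalEquality using (_≢_)

open import Data.Nat as ℕ using (zero; suc; z≤n; s≤s)
import Data.Nat.Properties as ℕ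
import Data.Nat.Divisibility as ℕ
import Data.Nat.Tactic.RingSolver as ℕ-Solver
open import Data.Nat.DivMod using (m*n/n≡m)
open import Data.Nat.Primality using (euclidsLemma; prime⇒irreducible; prime⇒nonTrivial)
open import Data.Integer as ℤ using (ℤ; +_; -_; _+_; _-_; _*_; _^_; 0ℤ; 1ℤ; -1ℤ)
import Data.Integer.Properties as ℤ
import Data.Integer.DivMod as ℤ
open import Data.Integer.Divisibility.Signed
open import Data.Integer.Tactic.RingSolver using (solve-∀)
open import Data.Product as Product using (∃; _,_; _×_; proj₁; proj₂)
open import Data.Sum as Sum using (_⊎_; inj₁; inj₂; [_,_]′)
open import Data.Empty using (⊥-elim)
open import Function using (_∘_; _⇔_; mk⇔; Equivalence)
open import Relation.Nullary using (¬_; yes; no)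
open import Data.List using (List; []; _∷_; _++_; _∷ʳ_; length; map; filter; applyUpTo; upTo)
open import Data.List.Properties using (applyUpTo-∷ʳ; length-++; length-upTo; length-applyUpTo; map-applyUpTo; map-++)
open import Data.Nat.ListAction using (sum)
open import Data.Nat.ListAction.Properties using (sum-++; sum-↭)
open import Data.List.Membership.Propositional using (_∈_)
open import Data.List.Membership.Propositional.Properties
  using (∈-++⁻; ∈-++⁺ˡ; ∈-++⁺ʳ; ∈-filter⁻; ∈-filter⁺; ∈-upTo⁺; ∈-applyUpTo⁻)
open import Data.List.Membership.Propositional.Properties.WithK using (unique∧set⇒bag)
open import Data.List.Membership.DecPropositional ℕ._≟_ using (_∈?_; _∉?_)
open import Data.List.Relation.Unary.Unique.Propositional using (Unique)
open import Data.List.Relation.Unary.Unique.Propositional.Properties using (++⁺; filter⁺; upTo⁺; applyUpTo⁺₁)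
open import Data.List.Relation.Binary.Permutation.Propositional using (_↭_)
open import Data.List.Relation.Binary.Permutation.Propositional.Properties using (↭-length; map⁺)
open import Data.List.Relation.Binary.BagAndSetEquality using (∼bag⇒↭)
open import Relation.Binary.PropositionalEquality
  using (_≡_; refl; sym; trans; cong; cong₂; subst; module ≡-Reasoning)

data EvenOrOdd : ℕ → Set where
  even : ∀ m → EvenOrOdd (m ℕ.+ m)
  odd  : ∀ m → EvenOrOdd (suc (m ℕ.+ m))

evenOrOdd : ∀ n → EvenOrOdd n
evenOrOdd zero = even 0
evenOrOdd (suc n) with evenOrOdd n
... | even m = odd m
... | odd m  = subst EvenOrOdd (cong suc (ℕ.+-suc m m)) (even (suc m))

m+m≡m*2 : ∀ m → m ℕ.+ m ≡ m ℕ.* 2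
m+m≡m*2 m = trans (cong (m ℕ.+_) (sym (ℕ.*-identityʳ m))) (sym (ℕ.*-suc m 1))

[m+m]/2≡m : ∀ m → (m ℕ.+ m) / 2 ≡ m
[m+m]/2≡m m = trans (cong (_/ 2) (m+m≡m*2 m)) (m*n/n≡m m 2)

odd-prime : ∀ {p} → Prime p → 2 < p → ∃ λ m → p ≡ suc (m ℕ.+ m)
odd-prime {p} p-prime 2<p with evenOrOdd p
... | odd m  = m , refl
... | even m with prime⇒irreducible p-prime (ℕ.divides m (m+m≡m*2 m))
...   | inj₁ ()
...   | inj₂ 2≡m+m = ⊥-elim (ℕ.<-irrefl 2≡m+m 2<p)

>⇒∤ : ∀ {p n} → suc n < p → ¬ + p ∣ + suc n
>⇒∤ n<p p∣n = ℕ.>⇒∤ n<p (∣⇒∣ᵤ p∣n)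

∤-neg : ∀ {d a} → ¬ d ∣ a → ¬ d ∣ - a
∤-neg {a = a} d∤a d∣-a = d∤a (subst (_ ∣_) (ℤ.neg-involutive a) (∣m⇒∣-m d∣-a))

∣m-n∣n⇒∣m : ∀ {d} a b → d ∣ a - b → d ∣ b → d ∣ a
∣m-n∣n⇒∣m a b d∣a-b d∣b = subst (_ ∣_) (cancel a b) (∣m∣n⇒∣m+n d∣a-b d∣b)
  where
  cancel : ∀ a b → a - b + b ≡ a
  cancel = solve-∀

∣m-n∣m⇒∣n : ∀ {d} a b → d ∣ a - b → d ∣ a → d ∣ b
∣m-n∣m⇒∣n a b d∣a-b d∣a = subst (_ ∣_) (cancel a b) (∣m∣n⇒∣m-n d∣a d∣a-b)
  where
  cancel : ∀ a b → a - (a - b) ≡ b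
  cancel = solve-∀

∣-<⇒≡0 : ∀ {d m} → d ℕ.∣ m → m < d → m ≡ 0
∣-<⇒≡0 {m = zero}  _   _   = refl
∣-<⇒≡0 {m = suc m} d∣m m<d = ⊥-elim (ℕ.>⇒∤ m<d d∣m)

[n/d]*d≡n : ∀ {d} .{{_ : ℤ.NonZero d}} {n} → d ∣ n → n ℤ./ d * d ≡ n
[n/d]*d≡n {d} {n} d∣n = sym (begin
  n                              ≡⟨ ℤ.a≡a%n+[a/n]*n n d ⟩
  + (n ℤ.% d) + n ℤ./ d * d      ≡⟨ cong (λ r → + r + n ℤ./ d * d) remainder≡0 ⟩
  0ℤ + n ℤ./ d * d               ≡⟨ ℤ.+-identityˡ _ ⟩
  n ℤ./ d * d                    ∎)
  where
  open ≡-Reasoning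
  cancel : ∀ r q → r + q - q ≡ r
  cancel = solve-∀
  d∣remainder : d ∣ + (n ℤ.% d)
  d∣remainder = subst (d ∣_) (trans (cong (_- n ℤ./ d * d) (ℤ.a≡a%n+[a/n]*n n d))
                                    (cancel (+ (n ℤ.% d)) (n ℤ./ d * d)))
                     (∣m∣n⇒∣m-n d∣n (∣n⇒∣m*n (n ℤ./ d) ∣-refl))
  remainder≡0 : n ℤ.% d ≡ 0
  remainder≡0 = ∣-<⇒≡0 (∣⇒∣ᵤ d∣remainder) (ℤ.n%d<d n d)

module _ {p : ℕ} (p-prime : Prime p) where

  ∣*⇒∣⊎∣ : ∀ {a b} → + p ∣ a * b → + p ∣ a ⊎ + p ∣ b
  ∣*⇒∣⊎∣ {a} {b} p∣ab =
    Sum.map ∣ᵤ⇒∣ ∣ᵤ⇒∣ (euclidsLemma ℤ.∣ a ∣ ℤ.∣ b ∣ p-prime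
                                   (subst (p ℕ.∣_) (ℤ.abs-* a b) (∣⇒∣ᵤ p∣ab)))

  ∤*∤ : ∀ {a b} → ¬ + p ∣ a → ¬ + p ∣ b → ¬ + p ∣ a * b
  ∤*∤ p∤a p∤b = [ p∤a , p∤b ]′ ∘ ∣*⇒∣⊎∣

  ∣*-cancelˡ : ∀ {a b} → ¬ + p ∣ a → + p ∣ a * b → + p ∣ b
  ∣*-cancelˡ p∤a p∣ab = [ (λ p∣a → ⊥-elim (p∤a p∣a)) , (λ p∣b → p∣b) ]′ (∣*⇒∣⊎∣ p∣ab)

  p∤1 : ¬ + p ∣ 1ℤ
  p∤1 = >⇒∤ (ℕ.nonTrivial⇒n>1 p {{prime⇒nonTrivial p-prime}})

  ∤^ : ∀ {a} → ¬ + p ∣ a → ∀ n → ¬ + p ∣ a ^ n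
  ∤^ p∤a zero    = p∤1
  ∤^ p∤a (suc n) = ∤*∤ p∤a (∤^ p∤a n)

∤qstar : ∀ {p q} → Prime p → Prime q → p ≢ q → ¬ + p ∣ qstar q
∤qstar {p} {q} p-prime q-prime p≢q = ∤*∤ p-prime (∤^ p-prime (∤-neg (p∤1 p-prime)) ((q ∸ 1) / 2)) p∤q
  where
  p∤q : ¬ + p ∣ + q
  p∤q p∣q with prime⇒irreducible q-prime (∣⇒∣ᵤ p∣q)
  ... | inj₁ p≡1 = ℕ.nonTrivial⇒≢1 {{prime⇒nonTrivial p-prime}} p≡1
  ... | inj₂ p≡q = p≢q p≡q

^-distribʳ-* : ∀ a b n → (a * b) ^ n ≡ a ^ n * b ^ n
^-distribʳ-* a b zero    = refl
^-distribʳ-* a b (suc n) = trans (cong (a * b *_) (^-distribʳ-* a b n)) (interchange a b (a ^ n) (b ^ n))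
  where
  interchange : ∀ a b x y → a * b * (x * y) ≡ a * x * (b * y)
  interchange = solve-∀

^-double : ∀ a n → a ^ (n ℕ.+ n) ≡ (a * a) ^ n
^-double a n = trans (ℤ.^-distribˡ-+-* a n n) (sym (^-distribʳ-* a a n))

[-1]^[n+n]≡1 : ∀ n → -1ℤ ^ (n ℕ.+ n) ≡ 1ℤ
[-1]^[n+n]≡1 n = trans (^-double -1ℤ n) (ℤ.^-zeroˡ n)

∑ : ℕ → (ℕ → ℤ) → ℤ
∑ zero    f = 0ℤ
∑ (suc n) f = ∑ n f + f n

infix 5 ∑
syntax ∑ n (λ j → e) = ∑[ j < n ] e

∑-cong : ∀ n {f g} → (∀ j → f j ≡ g j) → ∑ n f ≡ ∑ n g
∑-cong zero    f≗g = refl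
∑-cong (suc n) f≗g = cong₂ _+_ (∑-cong n f≗g) (f≗g n)

∑-+ : ∀ n f g → ∑[ j < n ] (f j + g j) ≡ ∑ n f + ∑ n g
∑-+ zero    f g = refl
∑-+ (suc n) f g = trans (cong (_+ (f n + g n)) (∑-+ n f g)) (interchange (∑ n f) (∑ n g) (f n) (g n))
  where
  interchange : ∀ a b c d → a + b + (c + d) ≡ a + c + (b + d)
  interchange = solve-∀

∑-- : ∀ n f g → ∑[ j < n ] (f j - g j) ≡ ∑ n f - ∑ n g
∑-- zero    f g = refl
∑-- (suc n) f g = trans (cong (_+ (f n - g n)) (∑-- n f g)) (interchange (∑ n f) (∑ n g) (f n) (g n))
  where
  interchange : ∀ a b c d → a - b + (c - d) ≡ a + c - (b + d)
  interchange = solve-∀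

∑-*ˡ : ∀ n c f → ∑[ j < n ] (c * f j) ≡ c * ∑ n f
∑-*ˡ zero    c f = sym (ℤ.*-zeroʳ c)
∑-*ˡ (suc n) c f = trans (cong (_+ c * f n) (∑-*ˡ n c f)) (sym (ℤ.*-distribˡ-+ c (∑ n f) (f n)))

∑-const : ∀ n c → ∑[ j < n ] c ≡ + n * c
∑-const zero    c = refl
∑-const (suc n) c = trans (cong (_+ c) (∑-const n c)) (step (+ n) c)
  where
  step : ∀ n c → n * c + c ≡ (1ℤ + n) * c
  step = solve-∀

∣-∑ : ∀ {d} n {f} → (∀ j → d ∣ f j) → d ∣ ∑ n f
∣-∑ zero    d∣f = ∣n⇒∣m*n 0ℤ ∣-refl
∣-∑ (suc n) d∣f = ∣m∣n⇒∣m+n (∣-∑ n d∣f) (d∣f n)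

∣∑-∑ : ∀ {d} n f g → (∀ j → d ∣ f j - g j) → d ∣ ∑ n f - ∑ n g
∣∑-∑ n f g d∣f-g = subst (_ ∣_) (∑-- n f g) (∣-∑ n d∣f-g)

∑-geometric : ∀ x n → (x - 1ℤ) * (∑[ j < n ] x ^ j) ≡ x ^ n - 1ℤ
∑-geometric x zero    = ℤ.*-zeroʳ (x - 1ℤ)
∑-geometric x (suc n) = begin
  (x - 1ℤ) * (∑ n (x ^_) + x ^ n)           ≡⟨ ℤ.*-distribˡ-+ (x - 1ℤ) _ (x ^ n) ⟩
  (x - 1ℤ) * ∑ n (x ^_) + (x - 1ℤ) * x ^ n  ≡⟨ cong (_+ (x - 1ℤ) * x ^ n) (∑-geometric x n) ⟩
  x ^ n - 1ℤ + (x - 1ℤ) * x ^ n             ≡⟨ telescope x (x ^ n) ⟩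
  x * x ^ n - 1ℤ                            ∎
  where
  open ≡-Reasoning
  telescope : ∀ x y → y - 1ℤ + (x - 1ℤ) * y ≡ x * y - 1ℤ
  telescope = solve-∀

2*∑-id : ∀ n → + 2 * (∑[ j < n ] + j) ≡ + n * (+ n - 1ℤ)
2*∑-id zero    = refl
2*∑-id (suc n) = trans (ℤ.*-distribˡ-+ (+ 2) (∑[ j < n ] + j) (+ n))
                       (trans (cong (_+ + 2 * + n) (2*∑-id n)) (step (+ n)))
  where
  step : ∀ n → n * (n - 1ℤ) + + 2 * n ≡ (1ℤ + n) * (1ℤ + n - 1ℤ)
  step = solve-∀

6*∑-sq : ∀ n → + 6 * (∑[ j < n ] + j * + j) ≡ + n * (+ n - 1ℤ) * (+ 2 * + n - 1ℤ)
6*∑-sq zero    = refl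
6*∑-sq (suc n) = trans (ℤ.*-distribˡ-+ (+ 6) (∑[ j < n ] (+ j * + j)) (+ n * + n))
                       (trans (cong (_+ + 6 * (+ n * + n)) (6*∑-sq n)) (step (+ n)))
  where
  step : ∀ n → n * (n - 1ℤ) * (+ 2 * n - 1ℤ) + + 6 * (n * n)
             ≡ (1ℤ + n) * (1ℤ + n - 1ℤ) * (+ 2 * (1ℤ + n) - 1ℤ)
  step = solve-∀

sum-∷ʳ : ∀ xs x → sum (xs ∷ʳ x) ≡ sum xs ℕ.+ x
sum-∷ʳ xs x = trans (sum-++ xs (x ∷ [])) (cong (sum xs ℕ.+_) (ℕ.+-identityʳ x))

sum-applyUpTo : ∀ g n → + sum (applyUpTo g n) ≡ ∑[ j < n ] + g j
sum-applyUpTo g zero    = refl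
sum-applyUpTo g (suc n) = begin
  + sum (applyUpTo g (suc n))            ≡⟨ cong (+_ ∘ sum) (applyUpTo-∷ʳ g n) ⟨
  + sum (applyUpTo g n ∷ʳ g n)           ≡⟨ cong +_ (sum-∷ʳ (applyUpTo g n) (g n)) ⟩
  + (sum (applyUpTo g n) ℕ.+ g n)        ≡⟨ ℤ.pos-+ (sum (applyUpTo g n)) (g n) ⟩
  + sum (applyUpTo g n) + + g n          ≡⟨ cong (_+ + g n) (sum-applyUpTo g n) ⟩
  ∑ n (+_ ∘ g) + + g n                   ∎
  where open ≡-Reasoning

sum-map-∷ʳ↭ : ∀ (g : ℕ → ℕ) {xs c ys} → xs ∷ʳ c ↭ ys → sum (map g xs) ℕ.+ g c ≡ sum (map g ys)
sum-map-∷ʳ↭ g {xs} {c} {ys} xs∷ʳc↭ys = begin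
  sum (map g xs) ℕ.+ g c   ≡⟨ sum-∷ʳ (map g xs) (g c) ⟨
  sum (map g xs ∷ʳ g c)    ≡⟨ cong sum (map-++ g xs (c ∷ [])) ⟨
  sum (map g (xs ∷ʳ c))    ≡⟨ sum-↭ (map⁺ g xs∷ʳc↭ys) ⟩
  sum (map g ys)           ∎
  where open ≡-Reasoning

length≡1 : ∀ {A : Set} {xs : List A} → length xs ≡ 1 → ∃ λ x → xs ≡ x ∷ []
length≡1 {xs = x ∷ []} refl = x , refl

unique-below⇒++missing↭upTo : ∀ {n xs} → Unique xs → (∀ {x} → x ∈ xs → x < n) →
                              xs ++ filter (_∉? xs) (upTo n) ↭ upTo n
unique-below⇒++missing↭upTo {n} {xs} xs! xs<n = ∼bag⇒↭ (unique∧set⇒bag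
  (++⁺ xs! (filter⁺ (_∉? xs) (upTo⁺ n))
       (λ (x∈xs , x∈missing) → proj₂ (∈-filter⁻ (_∉? xs) {xs = upTo n} x∈missing) x∈xs))
  (upTo⁺ n) (mk⇔ to from))
  where
  to : ∀ {x} → x ∈ xs ++ filter (_∉? xs) (upTo n) → x ∈ upTo n
  to x∈ = [ ∈-upTo⁺ ∘ xs<n , proj₁ ∘ ∈-filter⁻ (_∉? xs) {xs = upTo n} ]′ (∈-++⁻ xs x∈)
  from : ∀ {x} → x ∈ upTo n → x ∈ xs ++ filter (_∉? xs) (upTo n)
  from {x} x∈upTo with x ∈? xs
  ... | yes x∈xs = ∈-++⁺ˡ x∈xs
  ... | no  x∉xs = ∈-++⁺ʳ xs (∈-filter⁺ (_∉? xs) x∈upTo x∉xs)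

unique-below⇒∷ʳ↭upTo : ∀ {n xs} → Unique xs → (∀ {x} → x ∈ xs → x < suc n) → length xs ≡ n →
                       ∃ λ c → xs ∷ʳ c ↭ upTo (suc n)
unique-below⇒∷ʳ↭upTo {n} {xs} xs! xs<p |xs|≡n =
  Product.map₂ (λ missing≡[c] → subst (λ ys → xs ++ ys ↭ upTo (suc n)) missing≡[c] permutation)
               (length≡1 |missing|≡1)
  where
  missing : List ℕ
  missing = filter (_∉? xs) (upTo (suc n))
  permutation : xs ++ missing ↭ upTo (suc n)
  permutation = unique-below⇒++missing↭upTo xs! xs<p
  |missing|≡1 : length missing ≡ 1
  |missing|≡1 = ℕ.+-cancelˡ-≡ n (length missing) 1 (begin
    n ℕ.+ length missing          ≡⟨ cong (ℕ._+ length missing) |xs|≡n ⟨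
    length xs ℕ.+ length missing  ≡⟨ length-++ xs ⟨
    length (xs ++ missing)        ≡⟨ ↭-length permutation ⟩
    length (upTo (suc n))         ≡⟨ length-upTo (suc n) ⟩
    suc n                         ≡⟨ ℕ.+-comm 1 n ⟩
    n ℕ.+ 1                       ∎)
    where open ≡-Reasoning

-- v (qstar q) j = 4 u_q(j); working with v avoids the division by 4.
v : ℤ → ℕ → ℤ
v s j = (+ 3) ^ j - s * -1ℤ ^ j

4∣v : ∀ {s} → + 4 ∣ 1ℤ - s → ∀ j → + 4 ∣ v s j
4∣v {s} 4∣1-s zero    = subst (+ 4 ∣_) (cong (λ a → 1ℤ - a) (sym (ℤ.*-identityʳ s))) 4∣1-s
4∣v {s} 4∣1-s (suc j) =
  subst (+ 4 ∣_) (recurrence ((+ 3) ^ j) s (-1ℤ ^ j))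
        (∣m∣n⇒∣m+n (∣n⇒∣m*n (+ 3) (4∣v {s} 4∣1-s j)) (∣m⇒∣m*n (s * -1ℤ ^ j) ∣-refl))
  where
  recurrence : ∀ x s g → + 3 * (x - s * g) + + 4 * (s * g) ≡ + 3 * x - s * (-1ℤ * g)
  recurrence = solve-∀

4∣1-[-1]^m*[2m+1] : ∀ m → + 4 ∣ 1ℤ - -1ℤ ^ m * + suc (m ℕ.+ m)
4∣1-[-1]^m*[2m+1] zero          = divides 0ℤ refl
4∣1-[-1]^m*[2m+1] (suc zero)    = divides 1ℤ refl
4∣1-[-1]^m*[2m+1] (suc (suc m)) =
  subst (+ 4 ∣_) (trans (step (-1ℤ ^ m) (+ suc (m ℕ.+ m)))
                        (cong (λ a → 1ℤ - -1ℤ * (-1ℤ * -1ℤ ^ m) * a) (sym 2m+5)))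
        (∣m∣n⇒∣m-n (4∣1-[-1]^m*[2m+1] m) (∣m⇒∣m*n (-1ℤ ^ m) ∣-refl))
  where
  2m+5 : + suc (suc (suc m) ℕ.+ suc (suc m)) ≡ + suc (m ℕ.+ m) + + 4
  2m+5 = trans (cong +_ (ℕ-solve m)) (ℤ.pos-+ (suc (m ℕ.+ m)) 4)
    where
    ℕ-solve : ∀ m → suc (suc (suc m) ℕ.+ suc (suc m)) ≡ suc (m ℕ.+ m) ℕ.+ 4
    ℕ-solve = ℕ-Solver.solve-∀
  step : ∀ g a → 1ℤ - g * a - + 4 * g ≡ 1ℤ - -1ℤ * (-1ℤ * g) * (a + + 4)
  step = solve-∀

4*u≡v : ∀ m j → + 4 * u (suc (m ℕ.+ m)) j ≡ v (qstar (suc (m ℕ.+ m))) j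
4*u≡v m j = trans (ℤ.*-comm (+ 4) (u (suc (m ℕ.+ m)) j))
                  ([n/d]*d≡n {+ 4} (4∣v {qstar (suc (m ℕ.+ m))} 4∣1-q* j))
  where
  4∣1-q* : + 4 ∣ 1ℤ - qstar (suc (m ℕ.+ m))
  4∣1-q* = subst (λ e → + 4 ∣ 1ℤ - -1ℤ ^ e * + suc (m ℕ.+ m)) (sym ([m+m]/2≡m m)) (4∣1-[-1]^m*[2m+1] m)

v-shift : ∀ s m ρ → v s m - v s (m ℕ.+ ρ) ≡ (+ 3) ^ m * (1ℤ - (+ 3) ^ ρ) - s * -1ℤ ^ m * (1ℤ - -1ℤ ^ ρ)
v-shift s m ρ = begin
  v s m - v s (m ℕ.+ ρ)
    ≡⟨ cong₂ (λ a g → v s m - (a - s * g)) (ℤ.^-distribˡ-+-* (+ 3) m ρ) (ℤ.^-distribˡ-+-* -1ℤ m ρ) ⟩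
  (+ 3) ^ m - s * -1ℤ ^ m - ((+ 3) ^ m * (+ 3) ^ ρ - s * (-1ℤ ^ m * -1ℤ ^ ρ))
    ≡⟨ regroup ((+ 3) ^ m) ((+ 3) ^ ρ) (-1ℤ ^ m) (-1ℤ ^ ρ) s ⟩
  (+ 3) ^ m * (1ℤ - (+ 3) ^ ρ) - s * -1ℤ ^ m * (1ℤ - -1ℤ ^ ρ) ∎
  where
  open ≡-Reasoning
  regroup : ∀ x y g h s → x - s * g - (x * y - s * (g * h)) ≡ x * (1ℤ - y) - s * g * (1ℤ - h)
  regroup = solve-∀

v-suc : ∀ s j → v s (suc j) ≡ + 3 * (+ 3) ^ j + s * -1ℤ ^ j
v-suc s j = simplify ((+ 3) ^ j) s (-1ℤ ^ j)
  where
  simplify : ∀ x s g → + 3 * x - s * (-1ℤ * g) ≡ + 3 * x + s * g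
  simplify = solve-∀

v-suc² : ∀ s j → v s (suc j) * v s (suc j) ≡ + 9 * (+ 9) ^ j + + 6 * s * (- + 3) ^ j + s * s
v-suc² s j = begin
  v s (suc j) * v s (suc j)
    ≡⟨ expand x s g ⟩
  + 9 * (x * x) + + 6 * s * (x * g) + s * s * (g * g)
    ≡⟨ cong₂ (λ a b → + 9 * a + + 6 * s * b + s * s * (g * g))
             (sym (^-distribʳ-* (+ 3) (+ 3) j)) (sym (^-distribʳ-* (+ 3) -1ℤ j)) ⟩
  + 9 * (+ 9) ^ j + + 6 * s * (- + 3) ^ j + s * s * (g * g)
    ≡⟨ cong (λ a → + 9 * (+ 9) ^ j + + 6 * s * (- + 3) ^ j + s * s * a)
            (trans (sym (^-distribʳ-* -1ℤ -1ℤ j)) (ℤ.^-zeroˡ j)) ⟩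
  + 9 * (+ 9) ^ j + + 6 * s * (- + 3) ^ j + s * s * 1ℤ
    ≡⟨ cong (λ a → + 9 * (+ 9) ^ j + + 6 * s * (- + 3) ^ j + a) (ℤ.*-identityʳ (s * s)) ⟩
  + 9 * (+ 9) ^ j + + 6 * s * (- + 3) ^ j + s * s ∎
  where
  open ≡-Reasoning
  x g : ℤ
  x = (+ 3) ^ j
  g = -1ℤ ^ j
  expand : ∀ x s g → (+ 3 * x - s * (-1ℤ * g)) * (+ 3 * x - s * (-1ℤ * g))
                     ≡ + 9 * (x * x) + + 6 * s * (x * g) + s * s * (g * g)
  expand = solve-∀

module Prime>3 {n : ℕ} (p-prime : Prime (suc n)) (3<p : 3 < suc n) where

  p∤2 : ¬ + suc n ∣ + 2
  p∤2 = >⇒∤ (ℕ.<-trans (ℕ.n<1+n 2) 3<p)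

  p∤3 : ¬ + suc n ∣ + 3
  p∤3 = >⇒∤ 3<p

  p∤4 : ¬ + suc n ∣ + 4
  p∤4 = ∤*∤ p-prime p∤2 p∤2

  ∣u-u⇔∣v-v : ∀ m i j → + suc n ∣ u (suc (m ℕ.+ m)) i - u (suc (m ℕ.+ m)) j ⇔
                        + suc n ∣ v (qstar (suc (m ℕ.+ m))) i - v (qstar (suc (m ℕ.+ m))) j
  ∣u-u⇔∣v-v m i j = mk⇔ (λ p∣u-u → subst (+ suc n ∣_) 4*[u-u]≡v-v (∣n⇒∣m*n (+ 4) p∣u-u))
                        (λ p∣v-v → ∣*-cancelˡ p-prime p∤4 (subst (+ suc n ∣_) (sym 4*[u-u]≡v-v) p∣v-v))
    where
    q : ℕ
    q = suc (m ℕ.+ m)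
    distrib : ∀ a b → + 4 * (a - b) ≡ + 4 * a - + 4 * b
    distrib = solve-∀
    4*[u-u]≡v-v : + 4 * (u q i - u q j) ≡ v (qstar q) i - v (qstar q) j
    4*[u-u]≡v-v = trans (distrib (u q i) (u q j)) (cong₂ _-_ (4*u≡v m i) (4*u≡v m j))

  p∣∑^ : ∀ {x} m → ¬ + suc n ∣ x - 1ℤ → + suc n ∣ x ^ m - 1ℤ → + suc n ∣ ∑[ j < m ] x ^ j
  p∣∑^ {x} m p∤x-1 p∣x^m-1 = ∣*-cancelˡ p-prime p∤x-1 (subst (+ suc n ∣_) (sym (∑-geometric x m)) p∣x^m-1)

  p∣∑id : + suc n ∣ ∑[ j < suc n ] + j
  p∣∑id = ∣*-cancelˡ p-prime p∤2 (subst (+ suc n ∣_) (sym (2*∑-id (suc n))) (∣m⇒∣m*n _ ∣-refl))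

  p∣∑sq : + suc n ∣ ∑[ j < suc n ] + j * + j
  p∣∑sq = ∣*-cancelˡ p-prime (∤*∤ p-prime p∤2 p∤3)
    (subst (+ suc n ∣_) (sym (6*∑-sq (suc n)))
           (∣m⇒∣m*n (+ 2 * + suc n - 1ℤ) (∣m⇒∣m*n (+ suc n - 1ℤ) ∣-refl)))

  -- The residues of f 0, …, f (p − 2) are all residues modulo p but one, c. Comparing the sums of
  -- x and of x² over all residues with those over the residues of f gives p ∣ c, then the claim.
  ∣∑²-of-incongruent : ∀ f → (∀ {i j} → i < j → j < n → ¬ + suc n ∣ f i - f j) →
                       + suc n ∣ ∑ n f → + suc n ∣ ∑[ j < n ] f j * f j
  ∣∑²-of-incongruent f incongruent p∣∑f =
    ∣m-n∣n⇒∣m _ _ (∣∑-∑ n (λ j → f j * f j) (+_ ∘ sq ∘ r) p∣f²-r²) p∣∑r²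
    where
    sq : ℕ → ℕ
    sq x = x ℕ.* x

    r : ℕ → ℕ
    r j = f j ℤ.%ℕ suc n

    p∣f-r : ∀ j → + suc n ∣ f j - + r j
    p∣f-r j = divides (f j ℤ./ℕ suc n) (trans (cong (_- + r j) (ℤ.a≡a%ℕn+[a/ℕn]*n (f j) (suc n)))
                                              (cancel (+ r j) (f j ℤ./ℕ suc n) (+ suc n)))
      where
      cancel : ∀ r q p → r + q * p - r ≡ q * p
      cancel = solve-∀

    p∣f²-r² : ∀ j → + suc n ∣ f j * f j - + sq (r j)
    p∣f²-r² j = subst (+ suc n ∣_) (trans (difference-of-squares (f j) (+ r j))
                                         (cong (λ x → f j * f j - x) (sym (ℤ.pos-* (r j) (r j)))))
                      (∣m⇒∣m*n (f j + + r j) (p∣f-r j))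
      where
      difference-of-squares : ∀ a b → (a - b) * (a + b) ≡ a * a - b * b
      difference-of-squares = solve-∀

    incongruent-residues : ∀ {i j} → i < j → j < n → r i ≢ r j
    incongruent-residues {i} {j} i<j j<n rᵢ≡rⱼ = incongruent i<j j<n
      (subst (+ suc n ∣_) (cancel (f i) (f j) (+ r j))
        (∣m∣n⇒∣m-n (subst (λ m → + suc n ∣ f i - + m) rᵢ≡rⱼ (p∣f-r i)) (p∣f-r j)))
      where
      cancel : ∀ a b r → (a - r) - (b - r) ≡ a - b
      cancel = solve-∀

    residue<p : ∀ {x} → x ∈ applyUpTo r n → x < suc n
    residue<p x∈ with i , _ , refl ← ∈-applyUpTo⁻ r x∈ = ℤ.n%ℕd<d (f i) (suc n)

    missing : ∃ λ c → applyUpTo r n ∷ʳ c ↭ upTo (suc n)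
    missing = unique-below⇒∷ʳ↭upTo (applyUpTo⁺₁ r n incongruent-residues) residue<p (length-applyUpTo r n)

    c : ℕ
    c = proj₁ missing

    ∑-residues : ∀ g → ∑ n (+_ ∘ g ∘ r) + + g c ≡ ∑[ j < suc n ] + g j
    ∑-residues g = begin
      ∑ n (+_ ∘ g ∘ r) + + g c                   ≡⟨ cong (_+ + g c) (sum-applyUpTo (g ∘ r) n) ⟨
      + sum (applyUpTo (g ∘ r) n) + + g c        ≡⟨ ℤ.pos-+ _ (g c) ⟨
      + (sum (applyUpTo (g ∘ r) n) ℕ.+ g c)      ≡⟨ cong (λ xs → + (sum xs ℕ.+ g c)) (map-applyUpTo r g n) ⟨
      + (sum (map g (applyUpTo r n)) ℕ.+ g c)    ≡⟨ cong +_ (sum-map-∷ʳ↭ g (proj₂ missing)) ⟩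
      + sum (map g (upTo (suc n)))               ≡⟨ cong (+_ ∘ sum) (map-applyUpTo (λ x → x) g (suc n)) ⟩
      + sum (applyUpTo g (suc n))                ≡⟨ sum-applyUpTo g (suc n) ⟩
      ∑[ j < suc n ] + g j                       ∎
      where open ≡-Reasoning

    p∣∑r : + suc n ∣ ∑[ j < n ] + r j
    p∣∑r = ∣m-n∣m⇒∣n _ _ (∣∑-∑ n f (+_ ∘ r) p∣f-r) p∣∑f

    p∣c : + suc n ∣ + c
    p∣c = ∣m+n∣m⇒∣n (subst (+ suc n ∣_) (sym (∑-residues (λ x → x))) p∣∑id) p∣∑r

    p∣∑r² : + suc n ∣ ∑[ j < n ] + sq (r j)
    p∣∑r² = ∣m+n∣n⇒∣m (subst (+ suc n ∣_) (sym (∑-residues sq))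
                              (subst (+ suc n ∣_) (∑-cong (suc n) (λ j → sym (ℤ.pos-* j j))) p∣∑sq))
                      (subst (+ suc n ∣_) (sym (ℤ.pos-* c c)) (∣m⇒∣m*n (+ c) p∣c))


module _ {k : ℕ} (p-prime : Prime (suc (k ℕ.+ k))) (3<p : 3 < suc (k ℕ.+ k))
         {s : ℤ} (p∤s : ¬ + suc (k ℕ.+ k) ∣ s) where

  open Prime>3 p-prime 3<p

  v-periodic⇒ : ∀ m ρ → + suc (k ℕ.+ k) ∣ v s m - v s (m ℕ.+ ρ) →
                + suc (k ℕ.+ k) ∣ v s (suc m) - v s (suc m ℕ.+ ρ) →
                + suc (k ℕ.+ k) ∣ 1ℤ - (+ 3) ^ ρ × + suc (k ℕ.+ k) ∣ 1ℤ - -1ℤ ^ ρ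
  v-periodic⇒ m ρ p∣d₀ p∣d₁ =
    ∣*-cancelˡ p-prime (∤^ p-prime p∤3 m) p∣XA ,
    ∣*-cancelˡ p-prime (∤*∤ p-prime p∤s (∤^ p-prime (∤-neg (p∤1 p-prime)) m)) p∣sgB
    where
    X A g B : ℤ
    X = (+ 3) ^ m
    A = 1ℤ - (+ 3) ^ ρ
    g = -1ℤ ^ m
    B = 1ℤ - -1ℤ ^ ρ
    p∣d₀′ : + suc (k ℕ.+ k) ∣ X * A - s * g * B
    p∣d₀′ = subst (+ suc (k ℕ.+ k) ∣_) (v-shift s m ρ) p∣d₀
    -- Adding the differences at m and m + 1 cancels the (−1)^m terms.
    add : ∀ X A g B s → X * A - s * g * B + (+ 3 * X * A - s * (-1ℤ * g) * B) ≡ + 4 * (X * A)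
    add = solve-∀
    p∣XA : + suc (k ℕ.+ k) ∣ X * A
    p∣XA = ∣*-cancelˡ p-prime p∤4 (subst (+ suc (k ℕ.+ k) ∣_) (add X A g B s)
             (∣m∣n⇒∣m+n p∣d₀′ (subst (+ suc (k ℕ.+ k) ∣_) (v-shift s (suc m) ρ) p∣d₁)))
    p∣sgB : + suc (k ℕ.+ k) ∣ s * g * B
    p∣sgB = ∣m-n∣m⇒∣n (X * A) (s * g * B) p∣d₀′ p∣XA

  period-bound : (∀ r → 1 ≤ r → + suc (k ℕ.+ k) ∣ (+ 9) ^ r - 1ℤ → k ≤ r) →
                 ∀ ρ → 1 ≤ ρ → + suc (k ℕ.+ k) ∣ 1ℤ - (+ 3) ^ ρ → + suc (k ℕ.+ k) ∣ 1ℤ - -1ℤ ^ ρ →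
                 k ℕ.+ k ≤ ρ
  period-bound 9-order ρ 1≤ρ p∣1-3^ρ p∣1-[-1]^ρ with evenOrOdd ρ
  ... | odd r        =
    ⊥-elim (p∤2 (subst (λ g → + suc (k ℕ.+ k) ∣ 1ℤ - -1ℤ * g) ([-1]^[n+n]≡1 r) p∣1-[-1]^ρ))
  ... | even zero    = ⊥-elim (ℕ.<-irrefl refl 1≤ρ)
  ... | even (suc r) = ℕ.+-mono-≤ k≤r k≤r
    where
    negate : ∀ a → - (1ℤ - a) ≡ a - 1ℤ
    negate = solve-∀
    k≤r : k ≤ suc r
    k≤r = 9-order (suc r) (s≤s z≤n)
            (subst (+ suc (k ℕ.+ k) ∣_)
                   (trans (cong (λ a → - (1ℤ - a)) (^-double (+ 3) (suc r))) (negate ((+ 9) ^ suc r)))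
                   (∣m⇒∣-m p∣1-3^ρ))

  module _ (p∣9^k-1 : + suc (k ℕ.+ k) ∣ (+ 9) ^ k - 1ℤ) where

    p∣∑v : + suc (k ℕ.+ k) ∣ ∑[ j < k ℕ.+ k ] v s (suc j)
    p∣∑v = subst (+ suc (k ℕ.+ k) ∣_) (sym ∑v≡)
                 (∣m∣n⇒∣m+n (∣n⇒∣m*n (+ 3) p∣∑3^) (∣n⇒∣m*n s p∣∑[-1]^))
      where
      n : ℕ
      n = k ℕ.+ k
      ∑v≡ : ∑[ j < n ] v s (suc j) ≡ + 3 * ∑ n ((+ 3) ^_) + s * ∑ n (-1ℤ ^_)
      ∑v≡ = begin
        (∑[ j < n ] v s (suc j))                                   ≡⟨ ∑-cong n (v-suc s) ⟩
        (∑[ j < n ] + 3 * (+ 3) ^ j + s * -1ℤ ^ j)                 ≡⟨ ∑-+ n _ _ ⟩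
        (∑[ j < n ] + 3 * (+ 3) ^ j) + (∑[ j < n ] s * -1ℤ ^ j)    ≡⟨ cong₂ _+_ (∑-*ˡ n (+ 3) _) (∑-*ˡ n s _) ⟩
        + 3 * ∑ n ((+ 3) ^_) + s * ∑ n (-1ℤ ^_)                    ∎
        where open ≡-Reasoning
      p∣∑3^ : + suc n ∣ ∑ n ((+ 3) ^_)
      p∣∑3^ = p∣∑^ n p∤2 (subst (λ a → + suc n ∣ a - 1ℤ) (sym (^-double (+ 3) k)) p∣9^k-1)
      p∣∑[-1]^ : + suc n ∣ ∑ n (-1ℤ ^_)
      p∣∑[-1]^ = p∣∑^ n (∤-neg p∤2)
                      (subst (λ a → + suc n ∣ a - 1ℤ) (sym ([-1]^[n+n]≡1 k)) (divides 0ℤ refl))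

    p∣∑v²-n*s² : + suc (k ℕ.+ k) ∣ (∑[ j < k ℕ.+ k ] v s (suc j) * v s (suc j)) - + (k ℕ.+ k) * (s * s)
    p∣∑v²-n*s² = subst (+ suc (k ℕ.+ k) ∣_) (sym ∑v²-n*s²≡)
                       (∣m∣n⇒∣m+n (∣n⇒∣m*n (+ 9) p∣∑9^) (∣n⇒∣m*n (+ 6 * s) p∣∑[-3]^))
      where
      n : ℕ
      n = k ℕ.+ k
      cancel : ∀ a b c → a + b + c - c ≡ a + b
      cancel = solve-∀
      ∑v²-n*s²≡ : (∑[ j < n ] v s (suc j) * v s (suc j)) - + n * (s * s)
                  ≡ + 9 * ∑ n ((+ 9) ^_) + + 6 * s * ∑ n ((- + 3) ^_)
      ∑v²-n*s²≡ = begin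
        (∑[ j < n ] v s (suc j) * v s (suc j)) - + n * (s * s)
          ≡⟨ cong (_- + n * (s * s)) (∑-cong n (v-suc² s)) ⟩
        (∑[ j < n ] + 9 * (+ 9) ^ j + + 6 * s * (- + 3) ^ j + s * s) - + n * (s * s)
          ≡⟨ cong (_- + n * (s * s)) (trans (∑-+ n _ _) (cong₂ _+_ (∑-+ n _ _) (∑-const n (s * s)))) ⟩
        (∑[ j < n ] + 9 * (+ 9) ^ j) + (∑[ j < n ] + 6 * s * (- + 3) ^ j) + + n * (s * s) - + n * (s * s)
          ≡⟨ cancel (∑[ j < n ] + 9 * (+ 9) ^ j) (∑[ j < n ] + 6 * s * (- + 3) ^ j) (+ n * (s * s)) ⟩
        (∑[ j < n ] + 9 * (+ 9) ^ j) + (∑[ j < n ] + 6 * s * (- + 3) ^ j)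
          ≡⟨ cong₂ _+_ (∑-*ˡ n (+ 9) _) (∑-*ˡ n (+ 6 * s) _) ⟩
        + 9 * ∑ n ((+ 9) ^_) + + 6 * s * ∑ n ((- + 3) ^_) ∎
        where open ≡-Reasoning
      square : ∀ a → (a - 1ℤ) * (a + 1ℤ) ≡ a * a - 1ℤ
      square = solve-∀
      p∣9^n-1 : + suc n ∣ (+ 9) ^ n - 1ℤ
      p∣9^n-1 = subst (+ suc n ∣_) (trans (square ((+ 9) ^ k)) (cong (_- 1ℤ) (sym (ℤ.^-distribˡ-+-* (+ 9) k k))))
                      (∣m⇒∣m*n ((+ 9) ^ k + 1ℤ) p∣9^k-1)
      p∣∑9^ : + suc n ∣ ∑ n ((+ 9) ^_)
      p∣∑9^ = p∣∑^ n (∤*∤ p-prime p∤2 p∤4) p∣9^n-1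
      p∣∑[-3]^ : + suc n ∣ ∑ n ((- + 3) ^_)
      p∣∑[-3]^ = p∣∑^ n (∤-neg p∤4) (subst (λ a → + suc n ∣ a - 1ℤ) (sym (^-double (- + 3) k)) p∣9^k-1)

    ¬v-incongruent : ¬ (∀ {i j} → i < j → j < k ℕ.+ k → ¬ + suc (k ℕ.+ k) ∣ v s (suc i) - v s (suc j))
    ¬v-incongruent incongruent = p∤s (∣*-cancelˡ p-prime p∤s p∣s*s)
      where
      p∣n*s² : + suc (k ℕ.+ k) ∣ + (k ℕ.+ k) * (s * s)
      p∣n*s² = ∣m-n∣m⇒∣n _ _ p∣∑v²-n*s² (∣∑²-of-incongruent (v s ∘ suc) incongruent p∣∑v)
      cancel : ∀ a n → (1ℤ + n) * a - n * a ≡ a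
      cancel = solve-∀
      p∣s*s : + suc (k ℕ.+ k) ∣ s * s
      p∣s*s = subst (+ suc (k ℕ.+ k) ∣_) (cancel (s * s) (+ (k ℕ.+ k)))
                    (∣m∣n⇒∣m-n (∣m⇒∣m*n (s * s) ∣-refl) p∣n*s²)

lemma24 : (q p : ℕ) → Prime q → 5 ≤ q → Prime p → 3 < p → p ≢ q →
          IsOrder p 9 ((p ∸ 1) / 2) →
          (ι ρ : ℕ) → IsIncongruenceIndex q p ι → IsPeriod q p ρ → ι < ρ
lemma24 q p q-prime 5≤q p-prime 3<p p≢q (_ , 9^[p-1]/2≡1 , order-minimal)
        ι ρ (incongruent , _) ((1≤ρ , N , periodic) , _)
  with odd-prime q-prime (ℕ.≤-trans (ℕ.m≤m+n 3 2) 5≤q) | odd-prime p-prime (ℕ.<-trans (ℕ.n<1+n 2) 3<p)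
... | m , refl | k , refl =
  ℕ.≰⇒> λ ρ≤ι → ¬v-incongruent {k} p-prime 3<p p∤q* p∣9^k-1 (v-incongruent ρ≤ι)
  where
  open Prime>3 p-prime 3<p
  p∤q* : ¬ + p ∣ qstar q
  p∤q* = ∤qstar p-prime q-prime p≢q
  p∣9^k-1 : + p ∣ (+ 9) ^ k - 1ℤ
  p∣9^k-1 = ∣ᵤ⇒∣ (subst (λ e → ((+ 9) ^ e) ≡ (+ 1) [mod p ]) ([m+m]/2≡m k) 9^[p-1]/2≡1)
  9-order : ∀ r → 1 ≤ r → + p ∣ (+ 9) ^ r - 1ℤ → k ≤ r
  9-order r 1≤r p∣9^r-1 = subst (_≤ r) ([m+m]/2≡m k) (order-minimal r 1≤r (∣⇒∣ᵤ p∣9^r-1))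
  v-periodic : ∀ n → N ≤ n → 1 ≤ n → + p ∣ v (qstar q) n - v (qstar q) (n ℕ.+ ρ)
  v-periodic n N≤n 1≤n = Equivalence.to (∣u-u⇔∣v-v m n (n ℕ.+ ρ)) (∣ᵤ⇒∣ (periodic n N≤n 1≤n))
  2k≤ρ : k ℕ.+ k ≤ ρ
  2k≤ρ = Product.uncurry (period-bound {k} p-prime 3<p p∤q* 9-order ρ 1≤ρ)
           (v-periodic⇒ {k} p-prime 3<p p∤q* (suc N) ρ (v-periodic (suc N) (ℕ.n≤1+n N) (s≤s z≤n))
                                                 (v-periodic (suc (suc N)) (ℕ.m≤n+m N 2) (s≤s z≤n)))
  v-incongruent : ρ ≤ ι → ∀ {i j} → i < j → j < k ℕ.+ k →
                  ¬ + p ∣ v (qstar q) (suc i) - v (qstar q) (suc j)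
  v-incongruent ρ≤ι {i} {j} i<j j<2k p∣vᵢ-vⱼ =
    incongruent (suc i) (suc j) (s≤s z≤n) (s≤s i<j) (ℕ.≤-trans j<2k (ℕ.≤-trans 2k≤ρ ρ≤ι))
                (∣⇒∣ᵤ (Equivalence.from (∣u-u⇔∣v-v m (suc i) (suc j)) p∣vᵢ-vⱼ))
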